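{- Let $N$ be a positive odd integer and $r\ge s\ge 2$. The map $\Phi_r^s\to\Gamma_s/\Gamma_r$, $\begin{pmatrix}a&b\\c&d\end{pmatrix}\mapsto d\bmod\Gamma_r$, identifies the cokernel of the map $\Gamma_1(2^rN)^{\mathrm{ab}}\to\Phi_r^{s\,\mathrm{ab}}$ induced by inclusion with $\Gamma_s/\Gamma_r$. Under this identification, the endomorphism of this cokernel induced by the Atkin operator $U$ acts on $\Gamma_s/\Gamma_r$ as multiplication by $2$ (i.e. $x\mapsto x^2$ in multiplicative notation).
   Context: $\Phi_r^s=\Gamma_1(2^sN)\cap\Gamma_0(2^r)$, where $\Gamma_1(M)$ consists of matrices in $\mathrm{SL}_2(\mathbb{Z})$ congruent to $\begin{pmatrix}1&*\\0&1\end{pmatrix}$ mod $M$ and $\Gamma_0(M)$ of those with lower-left entry divisible by $M$. $\Gamma_r=1+2^r\mathbb{Z}_2\subset\mathbb{Z}_2^\times$. $\Gamma^0(2)$: matrices in $\mathrm{SL}_2(\mathbb{Z})$ with even upper-right entry; $t=\begin{pmatrix}1&0\\0&2\end{pmatrix}$. The Atkin operator $U$ on $\Phi_r^{s\,\mathrm{ab}}$ (and on $\Gamma_1(2^rN)^{\mathrm{ab}}=\Phi_r^{r\,\mathrm{ab}}$) is the composition of the transfer $\Phi_r^{s\,\mathrm{ab}}\to(\Phi_r^s\cap\Gamma^0(2))^{\mathrm{ab}}$, the isomorphism onto $\Phi_{r+1}^{s\,\mathrm{ab}}$ induced by $g\mapsto tgt^{ -1}$, and the map $\Phi_{r+1}^{s\,\mathrm{ab}}\to\Phi_r^{s\,\mathrm{ab}}$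 induced by inclusion; it commutes with maps induced by inclusions, so it induces an endomorphism of the cokernel. -}

module Defs where

open import Data.Nat as ℕ using (ℕ; _^_)
open import Data.Integer using (ℤ; +_; _+_; _*_; _-_; -_)
open import Data.Integer.Divisibility using (_∣_)
open import Data.Fin using (Fin; zero; suc)
open import Data.Product using (Σ; ∃; _×_)
open import Relation.Binary.PropositionalEquality using (_≡_)

_≡_[mod_] : ℤ → ℤ → ℕ → Set
x ≡ y [mod m ] = (+ m) ∣ (x - y)

record Mat : Set where
  constructor mat
  field
    a b c d : ℤ
open Mat public

_·_ : Mat → Mat → Mat
mat a₁ b₁ c₁ d₁ · mat a₂ b₂ c₂ d₂ =
  mat (a₁ * a₂ + b₁ * c₂) (a₁ * b₂ + b₁ * d₂) (c₁ * a₂ + d₁ * c₂) (c₁ * b₂ + d₁ * d₂)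
infixl 7 _·_

I : Mat
I = mat (+ 1) (+ 0) (+ 0) (+ 1)

det : Mat → ℤ
det (mat a b c d) = a * d - b * c

-- inverse of a matrix of determinant 1 (adjugate)
inv : Mat → Mat
inv (mat a b c d) = mat d (- b) (- c) a

t : Mat
t = mat (+ 1) (+ 0) (+ 0) (+ 2)

SL2 : Mat → Set
SL2 g = det g ≡ + 1

Γ₁ : ℕ → Mat → Set
Γ₁ M g = SL2 g × (a g ≡ + 1 [mod M ]) × (c g ≡ + 0 [mod M ]) × (d g ≡ + 1 [mod M ])

Γ₀ : ℕ → Mat → Set
Γ₀ M g = SL2 g × (c g ≡ + 0 [mod M ])

Γ⁰2 : Mat → Set
Γ⁰2 g = SL2 g × (b g ≡ + 0 [mod 2 ])

Φ : ℕ → ℕ → ℕ → Mat → Set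
Φ N r s g = Γ₁ (2 ^ s ℕ.* N) g × Γ₀ (2 ^ r) g

-- commutator subgroup of a subgroup P (products of commutators; the
-- inverse of a commutator is again a commutator)
data Comm (P : Mat → Set) : Mat → Set where
  one  : Comm P I
  step : ∀ {x y k} → P x → P y → Comm P k → Comm P (x · y · inv x · inv y · k)

-- the relation defining the cokernel of Γ₁(2^r N)^ab → (Φ_r^s)^ab :
-- g ~ h iff g h⁻¹ ∈ [Φ_r^s, Φ_r^s] · Γ₁(2^r N)
CokerRel : ℕ → ℕ → ℕ → Mat → Mat → Set
CokerRel N r s g h =
  Σ Mat λ k → Σ Mat λ m → Comm (Φ N r s) k × Γ₁ (2 ^ r ℕ.* N) m × (g · inv h ≡ k · m)

record Transversal (N r s : ℕ) : Set where
  field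
    n     : ℕ
    x     : Fin n → Mat
    inΦ   : ∀ i → Φ N r s (x i)
    cover : ∀ g → Φ N r s g → Σ (Fin n) λ i → Γ⁰2 (inv (x i) · g)
    disj  : ∀ i j → Γ⁰2 (inv (x i) · x j) → i ≡ j

prod : ∀ {n} → (Fin n → Mat) → Mat
prod {ℕ.zero} h = I
prod {ℕ.suc n} h = h zero · prod (λ i → h (suc i))

-- h : Fin n → Mat is the transfer data of g w.r.t. the transversal T:
-- g xᵢ = x_{σ(i)} hᵢ with hᵢ ∈ Φ_r^s ∩ Γ⁰(2); the transfer of g is ∏ hᵢ mod commutators
TransferData : ∀ {N r s} (T : Transversal N r s) → Mat → (Fin (Transversal.n T) → Mat) → Set
TransferData {N} {r} {s} T g h =
  ∀ i → (Φ N r s (h i) × Γ⁰2 (h i)) × Σ (Fin (Transversal.n T)) λ j → g · Transversal.x T i ≡ Transversal.x T j · h i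

-- On Φ_r^s the entry c vanishes mod 2^r, so d is multiplicative mod 2^r: it kills commutators
-- and Γ₁(2^r N), and conversely, by the Chinese remainder theorem for the coprime 2^r and N,
-- an element of Φ_r^s with d ≡ 1 mod 2^r lies in Γ₁(2^r N). Surjectivity comes from a bottom
-- row (2^r N, d₀) with d₀ chosen by CRT. For U: Φ_r^s ∩ Γ⁰(2) has index 2 in Φ_r^s, its cosets
-- being told apart by the parity of b, so the transfer of g is a product of two factors whose
-- d-entries multiply to d(g)² mod 2^r; conjugation by t leaves d unchanged.
module Submission where

open import Defs
open import Data.Nat as ℕ using (ℕ; zero; suc; _≤_; _^_)
import Data.Nat.Properties as ℕ
import Data.Nat.Divisibility as ℕ
open import Data.Nat.DivMod using (_%_; _/_; m≡m%n+[m/n]*n)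
open import Data.Integer using (ℤ; +_; _+_; _-_; -_; _*_; 0ℤ; 1ℤ)
import Data.Integer.Properties as ℤ
import Data.Integer.DivMod as ℤ
import Data.Integer.Divisibility.Signed as Signed
open import Data.Integer.Tactic.RingSolver using (solve-∀)
open import Data.Fin using (Fin; zero; suc)
open import Data.Fin.Properties using (¬Fin0; 0≢1+n; suc-injective)
open import Data.Product using (Σ; ∃₂; _×_; _,_; proj₁; proj₂; map₂)
open import Data.Sum using (_⊎_; inj₁; inj₂)
open import Data.Empty using (⊥; ⊥-elim)
open import Function using (_∘_)
open import Function.Bundles using (_⇔_; mk⇔; Equivalence)
open import Relation.Nullary using (¬_)
open import Relation.Binary.Bundles using (Setoid)
open import Relation.Binary.PropositionalEquality
import Relation.Binary.Reasoning.Setoid as SetoidReasoning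

private variable
  m n : ℕ
  w x y z u v : ℤ
  X Y : ℤ

-- x ≡ y [mod m ] unfolds to divisibility of an absolute value, from which Agda cannot
-- infer x and y; this record wrapper is injective, so the congruence lemmas below can
-- keep their arguments implicit.
record _≋_[mod_] (x y : ℤ) (m : ℕ) : Set where
  constructor ⟨_⟩
  field divides : + m Signed.∣ x - y
open _≋_[mod_]

≋⇒≡-mod : x ≋ y [mod m ] → x ≡ y [mod m ]
≋⇒≡-mod p = Signed.∣⇒∣ᵤ (divides p)

≡-mod⇒≋ : x ≡ y [mod m ] → x ≋ y [mod m ]
≡-mod⇒≋ p = ⟨ Signed.∣ᵤ⇒∣ p ⟩

≋-reflexive : x ≡ y → x ≋ y [mod m ]
≋-reflexive {x} refl = ⟨ Signed.divides 0ℤ (ℤ.+-inverseʳ x) ⟩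

≋-refl : x ≋ x [mod m ]
≋-refl = ≋-reflexive refl

≋-sym : x ≋ y [mod m ] → y ≋ x [mod m ]
≋-sym {x} {y} {m} p = ≡-mod⇒≋ (subst (m ℕ.∣_) (ℤ.∣i-j∣≡∣j-i∣ x y) (≋⇒≡-mod p))

≋-trans : x ≋ y [mod m ] → y ≋ z [mod m ] → x ≋ z [mod m ]
≋-trans {x} {y} {m} {z} ⟨ p ⟩ ⟨ q ⟩ =
  ⟨ subst (+ m Signed.∣_) (ℤ.+-minus-telescope x y z) (Signed.∣m∣n⇒∣m+n p q) ⟩

≋-setoid : ℕ → Setoid _ _
≋-setoid m = record
  { Carrier = ℤ
  ; _≈_ = λ x y → x ≋ y [mod m ]
  ; isEquivalence = record { refl = ≋-refl ; sym = ≋-sym ; trans = ≋-trans }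
  }

+-cong-≋ : x ≋ u [mod m ] → y ≋ v [mod m ] → (x + y) ≋ u + v [mod m ]
+-cong-≋ {x} {u} {m} {y} {v} ⟨ p ⟩ ⟨ q ⟩ =
  ⟨ subst (+ m Signed.∣_) (rearrange x y u v) (Signed.∣m∣n⇒∣m+n p q) ⟩
  where
  rearrange : ∀ x y u v → (x - u) + (y - v) ≡ (x + y) - (u + v)
  rearrange = solve-∀

*-cong-≋ : x ≋ u [mod m ] → y ≋ v [mod m ] → (x * y) ≋ u * v [mod m ]
*-cong-≋ {x} {u} {m} {y} {v} ⟨ p ⟩ ⟨ q ⟩ =
  ⟨ subst (+ m Signed.∣_) (rearrange x y u v)
          (Signed.∣m∣n⇒∣m+n (Signed.∣m⇒∣m*n y p) (Signed.∣n⇒∣m*n u q)) ⟩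
  where
  rearrange : ∀ x y u v → (x - u) * y + u * (y - v) ≡ x * y - u * v
  rearrange = solve-∀

neg-cong-≋ : x ≋ y [mod m ] → (- x) ≋ - y [mod m ]
neg-cong-≋ {x} {y} {m} ⟨ p ⟩ = ⟨ subst (+ m Signed.∣_) (rearrange x y) (Signed.∣m⇒∣-m p) ⟩
  where
  rearrange : ∀ x y → - (x - y) ≡ - x - - y
  rearrange = solve-∀

≋-∣ : m ℕ.∣ n → x ≋ y [mod n ] → x ≋ y [mod m ]
≋-∣ m∣n p = ≡-mod⇒≋ (ℕ.∣-trans m∣n (≋⇒≡-mod p))

*-≋0 : ∀ k → (k * + m) ≋ 0ℤ [mod m ]
*-≋0 {m} k = ⟨ Signed.divides k (ℤ.+-identityʳ (k * + m)) ⟩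

∣⇒≋0 : m ℕ.∣ n → (+ n) ≋ 0ℤ [mod m ]
∣⇒≋0 {m} {n} m∣n = ≡-mod⇒≋ (subst (m ℕ.∣_) (sym (ℕ.+-identityʳ n)) m∣n)

-≋0⇔≋ : (x - y) ≋ 0ℤ [mod m ] ⇔ x ≋ y [mod m ]
-≋0⇔≋ {x} {y} {m} = mk⇔ (λ p → ⟨ subst (+ m Signed.∣_) (ℤ.+-identityʳ (x - y)) (divides p) ⟩)
                        (λ p → ⟨ subst (+ m Signed.∣_) (sym (ℤ.+-identityʳ (x - y))) (divides p) ⟩)

+-cancelʳ-≋ : (x + z) ≋ y + z [mod m ] → x ≋ y [mod m ]
+-cancelʳ-≋ {x} {z} {y} p = ≋-trans (≋-reflexive (cancel x z))
  (≋-trans (+-cong-≋ p (≋-refl { - z})) (≋-reflexive (sym (cancel y z))))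
  where
  cancel : ∀ x z → x ≡ x + z + - z
  cancel = solve-∀

Bézout : ℤ → ℤ → Set
Bézout X Y = ∃₂ λ p q → p * X + q * Y ≡ 1ℤ

Bézout-sym : Bézout X Y → Bézout Y X
Bézout-sym {X} {Y} (p , q , e) = q , p , trans (ℤ.+-comm (q * Y) (p * X)) e

Bézout-*ˡ : Bézout X w → Bézout Y w → Bézout (X * Y) w
Bézout-*ˡ {X} {w} {Y} (p , q , e) (p′ , q′ , e′) =
  p * p′ , p * X * q′ + q * (p′ * Y) + q * q′ * w , (begin
    p * p′ * (X * Y) + (p * X * q′ + q * (p′ * Y) + q * q′ * w) * w ≡⟨ expand p q p′ q′ X Y w ⟩
    (p * X + q * w) * (p′ * Y + q′ * w)                             ≡⟨ cong₂ _*_ e e′ ⟩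
    1ℤ                                                              ∎)
  where
  open ≡-Reasoning
  expand : ∀ p q p′ q′ X Y w →
    p * p′ * (X * Y) + (p * X * q′ + q * (p′ * Y) + q * q′ * w) * w ≡ (p * X + q * w) * (p′ * Y + q′ * w)
  expand = solve-∀

≋1⇒Bézout : w ≋ 1ℤ [mod m ] → Bézout (+ m) w
≋1⇒Bézout {w} {m} ⟨ Signed.divides k eq ⟩ = - k , 1ℤ , (begin
    - k * + m + 1ℤ * w ≡⟨ rearrange k (+ m) w ⟩
    w - k * + m        ≡⟨ cong (λ e → w - e) eq ⟨
    w - (w - 1ℤ)       ≡⟨ cancel w ⟩
    1ℤ                 ∎)
  where
  open ≡-Reasoning
  rearrange : ∀ k m w → - k * m + 1ℤ * w ≡ w - k * m
  rearrange = solve-∀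
  cancel : ∀ w → w - (w - 1ℤ) ≡ 1ℤ
  cancel = solve-∀

Bézout⇒inverse : Bézout (+ m) w → Σ ℤ λ q → (q * w) ≋ 1ℤ [mod m ]
Bézout⇒inverse {m} {w} (p , q , e) = q , ⟨ Signed.divides (- p) (begin
    q * w - 1ℤ                  ≡⟨ cong (λ e → q * w - e) e ⟨
    q * w - (p * + m + q * w)   ≡⟨ cancel p q (+ m) w ⟩
    - p * + m                   ∎) ⟩
  where
  open ≡-Reasoning
  cancel : ∀ p q m w → q * w - (p * m + q * w) ≡ - p * m
  cancel = solve-∀

Bézout-2^ : w ≋ 1ℤ [mod 2 ] → ∀ r → Bézout (+ (2 ^ r)) w
Bézout-2^ w≋1 zero = 1ℤ , 0ℤ , refl
Bézout-2^ {w} w≋1 (suc r) = subst (λ X → Bézout X w) (sym (ℤ.pos-* 2 (2 ^ r)))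
  (Bézout-*ˡ (≋1⇒Bézout w≋1) (Bézout-2^ w≋1 r))

∣-crt : Bézout X Y → X Signed.∣ z → Y Signed.∣ z → X * Y Signed.∣ z
∣-crt {X} {Y} {z} (p , q , e) X∣z Y∣z = subst (X * Y Signed.∣_) combine
  (Signed.∣m∣n⇒∣m+n (Signed.∣n⇒∣m*n p (Signed.*-monoʳ-∣ X Y∣z))
                     (Signed.∣n⇒∣m*n q (Signed.*-monoˡ-∣ Y X∣z)))
  where
  open ≡-Reasoning
  expand : ∀ p q X Y z → p * (X * z) + q * (z * Y) ≡ (p * X + q * Y) * z
  expand = solve-∀
  combine : p * (X * z) + q * (z * Y) ≡ z
  combine = begin
    p * (X * z) + q * (z * Y) ≡⟨ expand p q X Y z ⟩
    (p * X + q * Y) * z       ≡⟨ cong (_* z) e ⟩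
    1ℤ * z                    ≡⟨ ℤ.*-identityˡ z ⟩
    z                         ∎

≋-crt : Bézout (+ m) (+ n) → x ≋ y [mod m ] → x ≋ y [mod n ] → x ≋ y [mod m ℕ.* n ]
≋-crt {m} {n} {x} {y} b ⟨ p ⟩ ⟨ q ⟩ = ⟨ subst (Signed._∣ x - y) (sym (ℤ.pos-* m n)) (∣-crt b p q) ⟩

crt-solution : Bézout (+ m) (+ n) → ∀ x y → Σ ℤ λ z → z ≋ x [mod m ] × z ≋ y [mod n ]
crt-solution {m} {n} b x y with Bézout⇒inverse b | Bézout⇒inverse (Bézout-sym b)
... | q , qn≋1 | p , pm≋1 = x * (q * + n) + y * (p * + m) , near-x , near-y
  where
  simplify : ∀ x y → x * 1ℤ + y * 0ℤ ≡ x
  simplify = solve-∀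
  near-x : (x * (q * + n) + y * (p * + m)) ≋ x [mod m ]
  near-x = ≋-trans (+-cong-≋ (*-cong-≋ (≋-refl {x}) qn≋1) (*-cong-≋ (≋-refl {y}) (*-≋0 p)))
                   (≋-reflexive (simplify x y))
  near-y : (x * (q * + n) + y * (p * + m)) ≋ y [mod n ]
  near-y = ≋-trans (+-cong-≋ (*-cong-≋ (≋-refl {x}) (*-≋0 q)) (*-cong-≋ (≋-refl {y}) pm≋1))
                   (≋-reflexive (trans (ℤ.+-comm (x * 0ℤ) (y * 1ℤ)) (simplify y x)))

odd⇒≋1 : ∀ {N} → N % 2 ≡ 1 → (+ N) ≋ 1ℤ [mod 2 ]
odd⇒≋1 {N} odd = ⟨ Signed.divides (+ (N / 2)) (begin
    + N - 1ℤ                         ≡⟨ cong (λ k → + k - 1ℤ) (m≡m%n+[m/n]*n N 2) ⟩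
    + (N % 2 ℕ.+ N / 2 ℕ.* 2) - 1ℤ   ≡⟨ cong (λ k → + (k ℕ.+ N / 2 ℕ.* 2) - 1ℤ) odd ⟩
    + (1 ℕ.+ N / 2 ℕ.* 2) - 1ℤ       ≡⟨ cong (_- 1ℤ) (ℤ.pos-+ 1 (N / 2 ℕ.* 2)) ⟩
    1ℤ + + (N / 2 ℕ.* 2) - 1ℤ        ≡⟨ cong (λ k → 1ℤ + k - 1ℤ) (ℤ.pos-* (N / 2) 2) ⟩
    1ℤ + + (N / 2) * + 2 - 1ℤ        ≡⟨ cancel (+ (N / 2)) ⟩
    + (N / 2) * + 2                  ∎) ⟩
  where
  open ≡-Reasoning
  cancel : ∀ k → 1ℤ + k * + 2 - 1ℤ ≡ k * + 2
  cancel = solve-∀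

private variable
  k : Mat

mat-≡ : ∀ {a b c d a′ b′ c′ d′} → a ≡ a′ → b ≡ b′ → c ≡ c′ → d ≡ d′ →
        mat a b c d ≡ mat a′ b′ c′ d′
mat-≡ refl refl refl refl = refl

·-identityˡ : ∀ g → I · g ≡ g
·-identityˡ (mat a b c d) = mat-≡ (identity a c) (identity b d) (identity′ a c) (identity′ b d)
  where
  identity : ∀ x y → 1ℤ * x + 0ℤ * y ≡ x
  identity = solve-∀
  identity′ : ∀ x y → 0ℤ * x + 1ℤ * y ≡ y
  identity′ = solve-∀

·-identityʳ : ∀ g → g · I ≡ g
·-identityʳ (mat a b c d) = mat-≡ (identity a b) (identity′ a b) (identity c d) (identity′ c d)
  where
  identity : ∀ x y → x * 1ℤ + y * 0ℤ ≡ x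
  identity = solve-∀
  identity′ : ∀ x y → x * 0ℤ + y * 1ℤ ≡ y
  identity′ = solve-∀

det-· : ∀ g h → det (g · h) ≡ det g * det h
det-· (mat a b c d) (mat a′ b′ c′ d′) = multiplicative a b c d a′ b′ c′ d′
  where
  multiplicative : ∀ a b c d a′ b′ c′ d′ →
    (a * a′ + b * c′) * (c * b′ + d * d′) - (a * b′ + b * d′) * (c * a′ + d * c′)
      ≡ (a * d - b * c) * (a′ * d′ - b′ * c′)
  multiplicative = solve-∀

det-inv : ∀ g → det (inv g) ≡ det g
det-inv (mat a b c d) = adjugate a b c d
  where
  adjugate : ∀ a b c d → d * a - - b * - c ≡ a * d - b * c
  adjugate = solve-∀

SL2-· : ∀ g h → SL2 g → SL2 h → SL2 (g · h)
SL2-· g h detg deth = trans (det-· g h) (cong₂ _*_ detg deth)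

SL2-inv : ∀ g → SL2 g → SL2 (inv g)
SL2-inv g = trans (det-inv g)

d-· : ∀ g h → c g ≋ 0ℤ [mod m ] → d (g · h) ≋ d g * d h [mod m ]
d-· {m} g h c≋0 = begin
  c g * b h + d g * d h  ≈⟨ +-cong-≋ (*-cong-≋ c≋0 (≋-refl {b h})) (≋-refl {d g * d h}) ⟩
  0ℤ * b h + d g * d h   ≡⟨ ℤ.+-identityˡ (d g * d h) ⟩
  d g * d h              ∎
  where open SetoidReasoning (≋-setoid m)

b-· : ∀ g h → a g ≋ 1ℤ [mod m ] → d h ≋ 1ℤ [mod m ] → b (g · h) ≋ b h + b g [mod m ]
b-· {m} g h a≋1 d≋1 = begin
  a g * b h + b g * d h  ≈⟨ +-cong-≋ (*-cong-≋ a≋1 (≋-refl {b h})) (*-cong-≋ (≋-refl {b g}) d≋1) ⟩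
  1ℤ * b h + b g * 1ℤ    ≡⟨ cong₂ _+_ (ℤ.*-identityˡ (b h)) (ℤ.*-identityʳ (b g)) ⟩
  b h + b g              ∎
  where open SetoidReasoning (≋-setoid m)

c-· : ∀ g h → c g ≋ 0ℤ [mod m ] → c h ≋ 0ℤ [mod m ] → c (g · h) ≋ 0ℤ [mod m ]
c-· {m} g h cg≋0 ch≋0 = begin
  c g * a h + d g * c h  ≈⟨ +-cong-≋ (*-cong-≋ cg≋0 (≋-refl {a h})) (*-cong-≋ (≋-refl {d g}) ch≋0) ⟩
  0ℤ * a h + d g * 0ℤ    ≡⟨ trans (ℤ.+-identityˡ (d g * 0ℤ)) (ℤ.*-zeroʳ (d g)) ⟩
  0ℤ                     ∎
  where open SetoidReasoning (≋-setoid m)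

Γ₀-c : ∀ g → Γ₀ m g → c g ≋ 0ℤ [mod m ]
Γ₀-c g = ≡-mod⇒≋ ∘ proj₂

Γ₀-· : ∀ g h → Γ₀ m g → Γ₀ m h → Γ₀ m (g · h)
Γ₀-· g h Γ₀g Γ₀h =
  SL2-· g h (proj₁ Γ₀g) (proj₁ Γ₀h) , ≋⇒≡-mod (c-· g h (Γ₀-c g Γ₀g) (Γ₀-c h Γ₀h))

Γ₀-inv : ∀ g → Γ₀ m g → Γ₀ m (inv g)
Γ₀-inv g Γ₀g = SL2-inv g (proj₁ Γ₀g) , ≋⇒≡-mod (neg-cong-≋ (Γ₀-c g Γ₀g))

Γ₀⇒a*d≋1 : ∀ g → Γ₀ m g → (a g * d g) ≋ 1ℤ [mod m ]
Γ₀⇒a*d≋1 {m} g Γ₀g = begin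
  a g * d g               ≡⟨ rearrange (a g) (b g) (c g) (d g) ⟩
  det g + b g * c g       ≈⟨ +-cong-≋ (≋-reflexive (proj₁ Γ₀g)) (*-cong-≋ (≋-refl {b g}) (Γ₀-c g Γ₀g)) ⟩
  1ℤ + b g * 0ℤ           ≡⟨ cong (_+_ 1ℤ) (ℤ.*-zeroʳ (b g)) ⟩
  1ℤ                      ∎
  where
  open SetoidReasoning (≋-setoid m)
  rearrange : ∀ a b c d → a * d ≡ (a * d - b * c) + b * c
  rearrange = solve-∀

Γ₁-a : ∀ g → Γ₁ m g → a g ≋ 1ℤ [mod m ]
Γ₁-a g = ≡-mod⇒≋ ∘ proj₁ ∘ proj₂

Γ₁-d : ∀ g → Γ₁ m g → d g ≋ 1ℤ [mod m ]
Γ₁-d g = ≡-mod⇒≋ ∘ proj₂ ∘ proj₂ ∘ proj₂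

Γ₁⇒Γ₀ : ∀ g → Γ₁ m g → Γ₀ m g
Γ₁⇒Γ₀ g (detg , _ , cg , _) = detg , cg

Γ₀∧d≋1⇒Γ₁ : ∀ g → Γ₀ m g → d g ≋ 1ℤ [mod m ] → Γ₁ m g
Γ₀∧d≋1⇒Γ₁ {m} g Γ₀g d≋1 = proj₁ Γ₀g , ≋⇒≡-mod a≋1 , proj₂ Γ₀g , ≋⇒≡-mod d≋1
  where
  open SetoidReasoning (≋-setoid m)
  a≋1 : a g ≋ 1ℤ [mod m ]
  a≋1 = begin
    a g       ≡⟨ ℤ.*-identityʳ (a g) ⟨
    a g * 1ℤ  ≈⟨ *-cong-≋ (≋-refl {a g}) d≋1 ⟨
    a g * d g ≈⟨ Γ₀⇒a*d≋1 g Γ₀g ⟩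
    1ℤ        ∎

Γ₁-I : Γ₁ m I
Γ₁-I = refl , ≋⇒≡-mod (≋-refl {1ℤ}) , ≋⇒≡-mod (≋-refl {0ℤ}) , ≋⇒≡-mod (≋-refl {1ℤ})

Γ₁-· : ∀ g h → Γ₁ m g → Γ₁ m h → Γ₁ m (g · h)
Γ₁-· {m} g h Γ₁g Γ₁h = Γ₀∧d≋1⇒Γ₁ (g · h) (Γ₀-· g h (Γ₁⇒Γ₀ g Γ₁g) (Γ₁⇒Γ₀ h Γ₁h)) (begin
  d (g · h)  ≈⟨ d-· g h (Γ₀-c g (Γ₁⇒Γ₀ g Γ₁g)) ⟩
  d g * d h  ≈⟨ *-cong-≋ (Γ₁-d g Γ₁g) (Γ₁-d h Γ₁h) ⟩
  1ℤ * 1ℤ    ≡⟨⟩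
  1ℤ         ∎)
  where open SetoidReasoning (≋-setoid m)

Γ₁-inv : ∀ g → Γ₁ m g → Γ₁ m (inv g)
Γ₁-inv g Γ₁g = Γ₀∧d≋1⇒Γ₁ (inv g) (Γ₀-inv g (Γ₁⇒Γ₀ g Γ₁g)) (Γ₁-a g Γ₁g)

Γ₁-∣ : ∀ g → m ℕ.∣ n → Γ₁ n g → Γ₁ m g
Γ₁-∣ g m∣n (detg , ag , cg , dg) = detg , ℕ.∣-trans m∣n ag , ℕ.∣-trans m∣n cg , ℕ.∣-trans m∣n dg

Γ₁-crt : ∀ g → Bézout (+ m) (+ n) → Γ₁ m g → Γ₁ n g → Γ₁ (m ℕ.* n) g
Γ₁-crt g bz Γ₁g Γ₁′g = Γ₀∧d≋1⇒Γ₁ g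
  (proj₁ Γ₁g , ≋⇒≡-mod (≋-crt bz (Γ₀-c g (Γ₁⇒Γ₀ g Γ₁g)) (Γ₀-c g (Γ₁⇒Γ₀ g Γ₁′g))))
  (≋-crt bz (Γ₁-d g Γ₁g) (Γ₁-d g Γ₁′g))

commutator∈Γ₁ : ∀ x y → Γ₀ m x → Γ₀ m y → Γ₁ m (x · y · inv x · inv y)
commutator∈Γ₁ {m} x y Γ₀x Γ₀y =
  Γ₀∧d≋1⇒Γ₁ (x · y · inv x · inv y) (Γ₀-· (x · y · inv x) (inv y) Γ₀xyx⁻¹ (Γ₀-inv y Γ₀y)) (begin
    d (x · y · inv x · inv y)  ≈⟨ d-· (x · y · inv x) (inv y) (Γ₀-c (x · y · inv x) Γ₀xyx⁻¹) ⟩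
    d (x · y · inv x) * a y    ≈⟨ *-cong-≋ (d-· (x · y) (inv x) (Γ₀-c (x · y) Γ₀xy)) (≋-refl {a y}) ⟩
    d (x · y) * a x * a y      ≈⟨ *-cong-≋ (*-cong-≋ (d-· x y (Γ₀-c x Γ₀x)) (≋-refl {a x})) (≋-refl {a y}) ⟩
    d x * d y * a x * a y      ≡⟨ regroup (a x) (d x) (a y) (d y) ⟩
    (a x * d x) * (a y * d y)  ≈⟨ *-cong-≋ (Γ₀⇒a*d≋1 x Γ₀x) (Γ₀⇒a*d≋1 y Γ₀y) ⟩
    1ℤ                         ∎)
  where
  open SetoidReasoning (≋-setoid m)
  Γ₀xy = Γ₀-· x y Γ₀x Γ₀y
  Γ₀xyx⁻¹ = Γ₀-· (x · y) (inv x) Γ₀xy (Γ₀-inv x Γ₀x)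
  regroup : ∀ ax dx ay dy → dx * dy * ax * ay ≡ (ax * dx) * (ay * dy)
  regroup = solve-∀

Comm⊆Γ₁ : ∀ {P} → (∀ g → P g → Γ₀ m g) → Comm P k → Γ₁ m k
Comm⊆Γ₁ P⊆Γ₀ one = Γ₁-I
Comm⊆Γ₁ P⊆Γ₀ (step {x} {y} {k} Px Py Ck) =
  Γ₁-· (x · y · inv x · inv y) k (commutator∈Γ₁ x y (P⊆Γ₀ x Px) (P⊆Γ₀ y Py)) (Comm⊆Γ₁ P⊆Γ₀ Ck)

d-·inv≋1⇔ : ∀ g h → Γ₀ m g → Γ₀ m h → (d (g · inv h) ≋ 1ℤ [mod m ] ⇔ d g ≋ d h [mod m ])
d-·inv≋1⇔ {m} g h Γ₀g Γ₀h = mk⇔ to from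
  where
  open SetoidReasoning (≋-setoid m)
  to : d (g · inv h) ≋ 1ℤ [mod m ] → d g ≋ d h [mod m ]
  to d≋1 = begin
    d g                  ≡⟨ ℤ.*-identityʳ (d g) ⟨
    d g * 1ℤ             ≈⟨ *-cong-≋ (≋-refl {d g}) (Γ₀⇒a*d≋1 h Γ₀h) ⟨
    d g * (a h * d h)    ≡⟨ ℤ.*-assoc (d g) (a h) (d h) ⟨
    d g * a h * d h      ≈⟨ *-cong-≋ (d-· g (inv h) (Γ₀-c g Γ₀g)) (≋-refl {d h}) ⟨
    d (g · inv h) * d h  ≈⟨ *-cong-≋ d≋1 (≋-refl {d h}) ⟩
    1ℤ * d h             ≡⟨ ℤ.*-identityˡ (d h) ⟩
    d h                  ∎
  from : d g ≋ d h [mod m ] → d (g · inv h) ≋ 1ℤ [mod m ]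
  from dg≋dh = begin
    d (g · inv h)  ≈⟨ d-· g (inv h) (Γ₀-c g Γ₀g) ⟩
    d g * a h      ≈⟨ *-cong-≋ dg≋dh (≋-refl {a h}) ⟩
    d h * a h      ≡⟨ ℤ.*-comm (d h) (a h) ⟩
    a h * d h      ≈⟨ Γ₀⇒a*d≋1 h Γ₀h ⟩
    1ℤ             ∎

^-monoʳ-∣ : ∀ b {i j} → i ≤ j → b ^ i ℕ.∣ b ^ j
^-monoʳ-∣ b {i} {j} i≤j = ℕ.divides (b ^ (j ℕ.∸ i)) (begin
  b ^ j                    ≡⟨ cong (b ^_) (ℕ.m+[n∸m]≡n i≤j) ⟨
  b ^ (i ℕ.+ (j ℕ.∸ i))    ≡⟨ ℕ.^-distribˡ-+-* b i (j ℕ.∸ i) ⟩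
  b ^ i ℕ.* b ^ (j ℕ.∸ i)  ≡⟨ ℕ.*-comm (b ^ i) (b ^ (j ℕ.∸ i)) ⟩
  b ^ (j ℕ.∸ i) ℕ.* b ^ i  ∎)
  where open ≡-Reasoning

Bézout-2^*-≋1 : ∀ r → w ≋ 1ℤ [mod 2 ] → w ≋ 1ℤ [mod n ] → Bézout (+ (2 ^ r ℕ.* n)) w
Bézout-2^*-≋1 {w} {n} r w≋1 w≋1′ = subst (λ X → Bézout X w) (sym (ℤ.pos-* (2 ^ r) n))
  (Bézout-*ˡ (Bézout-2^ w≋1 r) (≋1⇒Bézout w≋1′))

bottom-row-completion : Bézout z w → ∃₂ λ x y → SL2 (mat x y z w)
bottom-row-completion {z} {w} (p , q , e) = q , - p , trans (rearrange p q z w) e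
  where
  rearrange : ∀ p q z w → q * w - - p * z ≡ p * z + q * w
  rearrange = solve-∀

x≋x%2 : ∀ x → x ≋ + (x ℤ.% + 2) [mod 2 ]
x≋x%2 x = ⟨ Signed.divides (x ℤ./ + 2) (begin
  x - + (x ℤ.% + 2)                                ≡⟨ cong (λ e → e - + (x ℤ.% + 2)) (ℤ.a≡a%n+[a/n]*n x (+ 2)) ⟩
  + (x ℤ.% + 2) + x ℤ./ + 2 * + 2 - + (x ℤ.% + 2)  ≡⟨ cancel (+ (x ℤ.% + 2)) (x ℤ./ + 2 * + 2) ⟩
  x ℤ./ + 2 * + 2                                  ∎) ⟩
  where
  open ≡-Reasoning
  cancel : ∀ r q → r + q - r ≡ q
  cancel = solve-∀

≋0⊎≋1-mod2 : ∀ x → x ≋ 0ℤ [mod 2 ] ⊎ x ≋ 1ℤ [mod 2 ]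
≋0⊎≋1-mod2 x with x ℤ.% + 2 | ℤ.n%d<d x (+ 2) | x≋x%2 x
... | 0           | _               | x≋0 = inj₁ x≋0
... | 1           | _               | x≋1 = inj₂ x≋1
... | suc (suc _) | ℕ.s≤s (ℕ.s≤s ()) | _

mod2-pigeonhole : ∀ x y z → x ≋ y [mod 2 ] ⊎ x ≋ z [mod 2 ] ⊎ y ≋ z [mod 2 ]
mod2-pigeonhole x y z with ≋0⊎≋1-mod2 x | ≋0⊎≋1-mod2 y | ≋0⊎≋1-mod2 z
... | inj₁ x≋0 | inj₁ y≋0 | _        = inj₁ (≋-trans x≋0 (≋-sym y≋0))
... | inj₂ x≋1 | inj₂ y≋1 | _        = inj₁ (≋-trans x≋1 (≋-sym y≋1))
... | inj₁ x≋0 | inj₂ _   | inj₁ z≋0 = inj₂ (inj₁ (≋-trans x≋0 (≋-sym z≋0)))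
... | inj₂ x≋1 | inj₁ _   | inj₂ z≋1 = inj₂ (inj₁ (≋-trans x≋1 (≋-sym z≋1)))
... | inj₁ _   | inj₂ y≋1 | inj₂ z≋1 = inj₂ (inj₂ (≋-trans y≋1 (≋-sym z≋1)))
... | inj₂ _   | inj₁ y≋0 | inj₁ z≋0 = inj₂ (inj₂ (≋-trans y≋0 (≋-sym z≋0)))

1≉0-mod2 : ¬ (1ℤ ≋ 0ℤ [mod 2 ])
1≉0-mod2 1≋0 with ℕ.∣1⇒≡1 (≋⇒≡-mod 1≋0)
... | ()

Γ⁰2-b : ∀ h → Γ⁰2 h → b h ≋ 0ℤ [mod 2 ]
Γ⁰2-b h = ≡-mod⇒≋ ∘ proj₂

Γ⁰2-inv·⇔ : ∀ x y → Γ₁ 2 x → Γ₁ 2 y → Γ⁰2 (inv x · y) ⇔ b x ≋ b y [mod 2 ]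
Γ⁰2-inv·⇔ x y Γ₁x Γ₁y = mk⇔
  (λ Γ⁰2x⁻¹y → ≋-sym (Equivalence.to -≋0⇔≋ (≋-trans (≋-sym b≋) (Γ⁰2-b (inv x · y) Γ⁰2x⁻¹y))))
  (λ bx≋by → SL2-· (inv x) y (SL2-inv x (proj₁ Γ₁x)) (proj₁ Γ₁y)
           , ≋⇒≡-mod (≋-trans b≋ (Equivalence.from -≋0⇔≋ (≋-sym bx≋by))))
  where
  b≋ : b (inv x · y) ≋ b y - b x [mod 2 ]
  b≋ = b-· (inv x) y (Γ₁-d x Γ₁x) (Γ₁-d y Γ₁y)

Γ₁-unipotent : ∀ k → Γ₁ m (mat 1ℤ k 0ℤ 1ℤ)
Γ₁-unipotent k =
  cong (_-_ 1ℤ) (ℤ.*-zeroʳ k) , ≋⇒≡-mod (≋-refl {1ℤ}) , ≋⇒≡-mod (≋-refl {0ℤ}) , ≋⇒≡-mod (≋-refl {1ℤ})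

d-transfer-step : ∀ g x x′ h → Γ₀ m g → Γ₀ m x′ → g · x ≡ x′ · h → d h ≋ a x′ * (d g * d x) [mod m ]
d-transfer-step {m} g x x′ h Γ₀g Γ₀x′ gx≡x′h = begin
  d h                    ≡⟨ ℤ.*-identityˡ (d h) ⟨
  1ℤ * d h               ≈⟨ *-cong-≋ (Γ₀⇒a*d≋1 x′ Γ₀x′) (≋-refl {d h}) ⟨
  a x′ * d x′ * d h      ≡⟨ ℤ.*-assoc (a x′) (d x′) (d h) ⟩
  a x′ * (d x′ * d h)    ≈⟨ *-cong-≋ (≋-refl {a x′}) (d-· x′ h (Γ₀-c x′ Γ₀x′)) ⟨
  a x′ * d (x′ · h)      ≡⟨ cong (λ e → a x′ * d e) gx≡x′h ⟨
  a x′ * d (g · x)       ≈⟨ *-cong-≋ (≋-refl {a x′}) (d-· g x (Γ₀-c g Γ₀g)) ⟩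
  a x′ * (d g * d x)     ∎
  where open SetoidReasoning (≋-setoid m)

b-transfer-step : ∀ g x x′ h → Γ₁ 2 g → Γ₁ 2 x → Γ₁ 2 x′ → Γ₁ 2 h → Γ⁰2 h → g · x ≡ x′ · h →
                  b x′ ≋ b x + b g [mod 2 ]
b-transfer-step g x x′ h Γ₁g Γ₁x Γ₁x′ Γ₁h Γ⁰2h gx≡x′h = begin
  b x′               ≡⟨ ℤ.+-identityˡ (b x′) ⟨
  0ℤ + b x′          ≈⟨ +-cong-≋ (Γ⁰2-b h Γ⁰2h) (≋-refl {b x′}) ⟨
  b h + b x′         ≈⟨ b-· x′ h (Γ₁-a x′ Γ₁x′) (Γ₁-d h Γ₁h) ⟨
  b (x′ · h)         ≡⟨ cong b gx≡x′h ⟨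
  b (g · x)          ≈⟨ b-· g x (Γ₁-a g Γ₁g) (Γ₁-d x Γ₁x) ⟩
  b x + b g          ∎
  where open SetoidReasoning (≋-setoid 2)

d-conj-t : ∀ u v → u · t ≡ t · v → d u ≡ d v
d-conj-t u v ut≡tv = ℤ.*-cancelʳ-≡ (d u) (d v) (+ 2) (begin
  d u * + 2                   ≡⟨ simplify (c u) (d u) ⟨
  c u * 0ℤ + d u * + 2        ≡⟨ cong d ut≡tv ⟩
  0ℤ * b v + + 2 * d v        ≡⟨ simplify′ (b v) (d v) ⟩
  d v * + 2                   ∎)
  where
  open ≡-Reasoning
  simplify : ∀ c d → c * 0ℤ + d * + 2 ≡ d * + 2
  simplify = solve-∀
  simplify′ : ∀ b d → 0ℤ * b + + 2 * d ≡ d * + 2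
  simplify′ = solve-∀

module _ (N r s : ℕ) where

  CokerRel⇔d≡ : (+ N) ≋ 1ℤ [mod 2 ] → ∀ g h → Φ N r s g → Φ N r s h →
                CokerRel N r s g h ⇔ (d g ≡ d h [mod 2 ^ r ])
  CokerRel⇔d≡ N-odd g h (Γ₁g , Γ₀g) (Γ₁h , Γ₀h) = mk⇔ (≋⇒≡-mod ∘ to) (from ∘ ≡-mod⇒≋)
    where
    d≋1⇔ = d-·inv≋1⇔ g h Γ₀g Γ₀h
    to : CokerRel N r s g h → d g ≋ d h [mod 2 ^ r ]
    to (k , m′ , Ck , Γ₁m′ , eq) = Equivalence.to d≋1⇔ (Γ₁-d (g · inv h)
      (subst (Γ₁ (2 ^ r)) (sym eq) (Γ₁-· k m′ (Comm⊆Γ₁ (λ _ → proj₂) Ck) (Γ₁-∣ m′ (ℕ.m∣m*n N) Γ₁m′))))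
    from : d g ≋ d h [mod 2 ^ r ] → CokerRel N r s g h
    from dg≋dh = I , g · inv h , one , Γ₁-crt (g · inv h) (Bézout-2^ N-odd r) Γ₁-2^r Γ₁-N
               , sym (·-identityˡ (g · inv h))
      where
      Γ₁-2^r : Γ₁ (2 ^ r) (g · inv h)
      Γ₁-2^r = Γ₀∧d≋1⇒Γ₁ (g · inv h) (Γ₀-· g (inv h) Γ₀g (Γ₀-inv h Γ₀h)) (Equivalence.from d≋1⇔ dg≋dh)
      Γ₁-N : Γ₁ N (g · inv h)
      Γ₁-N = Γ₁-· g (inv h) (Γ₁-∣ g (ℕ.n∣m*n (2 ^ s)) Γ₁g) (Γ₁-inv h (Γ₁-∣ h (ℕ.n∣m*n (2 ^ s)) Γ₁h))

  -- d₀ is prime to c₀ = 2^r N, so (c₀, d₀) is the bottom row of a matrix in SL₂(ℤ).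
  Φ-with-d : (+ N) ≋ 1ℤ [mod 2 ] → 1 ≤ s → s ≤ r → ∀ d₀ → d₀ ≋ 1ℤ [mod 2 ^ s ] → d₀ ≋ 1ℤ [mod N ] →
             Σ Mat λ g → Φ N r s g × d g ≡ d₀
  Φ-with-d N-odd 1≤s s≤r d₀ d₀≋1 d₀≋1′ = g₀ , (Γ₁g₀ , Γ₀g₀) , refl
    where
    completion = bottom-row-completion (Bézout-2^*-≋1 r (≋-∣ (^-monoʳ-∣ 2 1≤s) d₀≋1) d₀≋1′)
    g₀ : Mat
    g₀ = mat (proj₁ completion) (proj₁ (proj₂ completion)) (+ (2 ^ r ℕ.* N)) d₀
    SL2g₀ : SL2 g₀
    SL2g₀ = proj₂ (proj₂ completion)
    Γ₀g₀ : Γ₀ (2 ^ r) g₀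
    Γ₀g₀ = SL2g₀ , ≋⇒≡-mod {+ (2 ^ r ℕ.* N)} {0ℤ} (∣⇒≋0 (ℕ.m∣m*n N))
    Γ₁g₀ : Γ₁ (2 ^ s ℕ.* N) g₀
    Γ₁g₀ = Γ₀∧d≋1⇒Γ₁ g₀
      (SL2g₀ , ≋⇒≡-mod {+ (2 ^ r ℕ.* N)} {0ℤ} (∣⇒≋0 (ℕ.*-monoˡ-∣ N (^-monoʳ-∣ 2 s≤r))))
      (≋-crt (Bézout-2^ N-odd s) d₀≋1 d₀≋1′)

  d-surjective : ∀ {y} → (+ N) ≋ 1ℤ [mod 2 ] → 1 ≤ s → s ≤ r → y ≋ 1ℤ [mod 2 ^ s ] →
                 Σ Mat λ g → Φ N r s g × d g ≋ y [mod 2 ^ r ]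
  d-surjective {y} N-odd 1≤s s≤r y≋1 =
    let d₀ , d₀≋y , d₀≋1 = crt-solution (Bézout-2^ N-odd r) y 1ℤ
        g , Φg , dg≡d₀ = Φ-with-d N-odd 1≤s s≤r d₀ (≋-trans (≋-∣ (^-monoʳ-∣ 2 s≤r) d₀≋y) y≋1) d₀≋1
    in g , Φg , ≋-trans (≋-reflexive dg≡d₀) d₀≋y

  Φ-unipotent : ∀ k → Φ N r s (mat 1ℤ k 0ℤ 1ℤ)
  Φ-unipotent k = Γ₁-unipotent k , Γ₁⇒Γ₀ (mat 1ℤ k 0ℤ 1ℤ) (Γ₁-unipotent k)

  module _ (1≤s : 1 ≤ s) where

    Φ⇒Γ₁2 : ∀ g → Φ N r s g → Γ₁ 2 g
    Φ⇒Γ₁2 g (Γ₁g , _) = Γ₁-∣ g (ℕ.∣-trans (^-monoʳ-∣ 2 1≤s) (ℕ.m∣m*n N)) Γ₁g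

    same-b-parity⇒≡ : (T : Transversal N r s) → ∀ i j →
                      b (Transversal.x T i) ≋ b (Transversal.x T j) [mod 2 ] → i ≡ j
    same-b-parity⇒≡ record { x = x ; inΦ = inΦ ; disj = disj } i j bi≋bj = disj i j
      (Equivalence.from (Γ⁰2-inv·⇔ (x i) (x j) (Φ⇒Γ₁2 (x i) (inΦ i)) (Φ⇒Γ₁2 (x j) (inΦ j))) bi≋bj)

    transversal-size : (T : Transversal N r s) → Transversal.n T ≡ 2
    transversal-size record { n = zero ; cover = cover } = ⊥-elim (¬Fin0 (proj₁ (cover I (Φ-unipotent 0ℤ))))
    transversal-size record { n = 1 ; x = x ; inΦ = inΦ ; cover = cover } =
      ⊥-elim (distinct-parities (cover I (Φ-unipotent 0ℤ)) (cover unipotent (Φ-unipotent 1ℤ)))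
      where
      unipotent = mat 1ℤ 1ℤ 0ℤ 1ℤ
      b-parity : ∀ k → Γ⁰2 (inv (x zero) · mat 1ℤ k 0ℤ 1ℤ) → b (x zero) ≋ k [mod 2 ]
      b-parity k = Equivalence.to
        (Γ⁰2-inv·⇔ (x zero) (mat 1ℤ k 0ℤ 1ℤ) (Φ⇒Γ₁2 (x zero) (inΦ zero)) (Γ₁-unipotent k))
      distinct-parities : Σ (Fin 1) (λ i → Γ⁰2 (inv (x i) · I)) →
                          Σ (Fin 1) (λ i → Γ⁰2 (inv (x i) · unipotent)) → ⊥
      distinct-parities (zero , p) (zero , q) = 1≉0-mod2 (≋-trans (≋-sym (b-parity 1ℤ q)) (b-parity 0ℤ p))
    transversal-size record { n = 2 } = refl
    transversal-size T@record { n = suc (suc (suc _)) ; x = x } =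
      ⊥-elim (two-equal (mod2-pigeonhole (b (x zero)) (b (x (suc zero))) (b (x (suc (suc zero))))))
      where
      two-equal : b (x zero) ≋ b (x (suc zero)) [mod 2 ] ⊎ b (x zero) ≋ b (x (suc (suc zero))) [mod 2 ]
                  ⊎ b (x (suc zero)) ≋ b (x (suc (suc zero))) [mod 2 ] → ⊥
      two-equal (inj₁ p)        = 0≢1+n (same-b-parity⇒≡ T zero (suc zero) p)
      two-equal (inj₂ (inj₁ p)) = 0≢1+n (same-b-parity⇒≡ T zero (suc (suc zero)) p)
      two-equal (inj₂ (inj₂ p)) = 0≢1+n (suc-injective (same-b-parity⇒≡ T (suc zero) (suc (suc zero)) p))

    -- With two cosets, g by-targets them: the transfer of g is h₀ h₁ with
    -- d hᵢ ≡ a x_{σ i} · d g · d xᵢ, and the a's and d's of the transversal cancel in pairs.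
    d-transfer : (T : Transversal N r s) → ∀ g h → Φ N r s g → TransferData T g h →
                 d (prod h) ≋ d g * d g [mod 2 ^ r ]
    d-transfer T@record { x = x ; inΦ = inΦ } g h Φg th with refl ← transversal-size T =
      by-targets (proj₁ (proj₂ (th zero))) (proj₁ (proj₂ (th (suc zero))))
               (proj₂ (proj₂ (th zero))) (proj₂ (proj₂ (th (suc zero))))
      where
      open SetoidReasoning (≋-setoid (2 ^ r))
      x₀ = x zero
      x₁ = x (suc zero)
      h₀ = h zero
      h₁ = h (suc zero)
      Φh₀ = proj₁ (proj₁ (th zero))

      a*d≋1 : ∀ i → (a (x i) * d (x i)) ≋ 1ℤ [mod 2 ^ r ]
      a*d≋1 i = Γ₀⇒a*d≋1 (x i) (proj₂ (inΦ i))

      d-step : ∀ i j → g · x i ≡ x j · h i → d (h i) ≋ a (x j) * (d g * d (x i)) [mod 2 ^ r ]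
      d-step i j = d-transfer-step g (x i) (x j) (h i) (proj₂ Φg) (proj₂ (inΦ j))

      target-injective : ∀ i i′ j → g · x i ≡ x j · h i → g · x i′ ≡ x j · h i′ → i ≡ i′
      target-injective i i′ j e e′ =
        same-b-parity⇒≡ T i i′ (+-cancelʳ-≋ (≋-trans (≋-sym (parity i e)) (parity i′ e′)))
        where
        parity : ∀ i → g · x i ≡ x j · h i → b (x j) ≋ b (x i) + b g [mod 2 ]
        parity i = b-transfer-step g (x i) (x j) (h i) (Φ⇒Γ₁2 g Φg) (Φ⇒Γ₁2 (x i) (inΦ i)) (Φ⇒Γ₁2 (x j) (inΦ j))
                     (Φ⇒Γ₁2 (h i) (proj₁ (proj₁ (th i)))) (proj₂ (proj₁ (th i)))

      regroup : ∀ a a′ d d′ dg → (a * (dg * d)) * (a′ * (dg * d′)) ≡ (a * a′) * (d * d′) * (dg * dg)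
      regroup = solve-∀
      pair : ∀ a a′ d d′ dg → (a * a′) * (d * d′) * dg ≡ (a * d) * (a′ * d′) * dg
      pair = solve-∀

      squares : ∀ j₀ j₁ → a (x j₀) * a (x j₁) ≡ a x₀ * a x₁ →
                g · x₀ ≡ x j₀ · h₀ → g · x₁ ≡ x j₁ · h₁ → d (prod h) ≋ d g * d g [mod 2 ^ r ]
      squares j₀ j₁ a-perm e₀ e₁ = begin
        d (h₀ · (h₁ · I))
          ≈⟨ d-· h₀ (h₁ · I) (Γ₀-c h₀ (proj₂ Φh₀)) ⟩
        d h₀ * d (h₁ · I)
          ≡⟨ cong (λ e → d h₀ * d e) (·-identityʳ h₁) ⟩
        d h₀ * d h₁
          ≈⟨ *-cong-≋ (d-step zero j₀ e₀) (d-step (suc zero) j₁ e₁) ⟩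
        (a (x j₀) * (d g * d x₀)) * (a (x j₁) * (d g * d x₁))
          ≡⟨ regroup (a (x j₀)) (a (x j₁)) (d x₀) (d x₁) (d g) ⟩
        (a (x j₀) * a (x j₁)) * (d x₀ * d x₁) * (d g * d g)
          ≡⟨ cong (λ e → e * (d x₀ * d x₁) * (d g * d g)) a-perm ⟩
        (a x₀ * a x₁) * (d x₀ * d x₁) * (d g * d g)
          ≡⟨ pair (a x₀) (a x₁) (d x₀) (d x₁) (d g * d g) ⟩
        (a x₀ * d x₀) * (a x₁ * d x₁) * (d g * d g)
          ≈⟨ *-cong-≋ (*-cong-≋ (a*d≋1 zero) (a*d≋1 (suc zero))) (≋-refl {d g * d g}) ⟩
        1ℤ * 1ℤ * (d g * d g)
          ≡⟨ ℤ.*-identityˡ (d g * d g) ⟩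
        d g * d g
          ∎

      by-targets : ∀ j₀ j₁ → g · x₀ ≡ x j₀ · h₀ → g · x₁ ≡ x j₁ · h₁ → d (prod h) ≋ d g * d g [mod 2 ^ r ]
      by-targets zero       (suc zero) e₀ e₁ = squares zero (suc zero) refl e₀ e₁
      by-targets (suc zero) zero       e₀ e₁ = squares (suc zero) zero (ℤ.*-comm (a x₁) (a x₀)) e₀ e₁
      by-targets zero       zero       e₀ e₁ = ⊥-elim (0≢1+n (target-injective zero (suc zero) zero e₀ e₁))
      by-targets (suc zero) (suc zero) e₀ e₁ = ⊥-elim (0≢1+n (target-injective zero (suc zero) (suc zero) e₀ e₁))

lemma3p4 : (N r s : ℕ) → 1 ≤ N → N % 2 ≡ 1 → 2 ≤ s → s ≤ r →
    -- the map d mod 2^r is a homomorphism Φ_r^s → Γ_s/Γ_r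
    ((g h : Mat) → Φ N r s g → Φ N r s h → d (g · h) ≡ d g * d h [mod 2 ^ r ])
    -- it is well defined and injective on the cokernel
    × ((g h : Mat) → Φ N r s g → Φ N r s h → (CokerRel N r s g h ⇔ (d g ≡ d h [mod 2 ^ r ])))
    -- it is surjective onto Γ_s/Γ_r
    × ((y : ℤ) → y ≡ + 1 [mod 2 ^ s ] → Σ Mat λ g → Φ N r s g × (d g ≡ y [mod 2 ^ r ]))
    -- the Atkin operator U acts as squaring: for a transversal T, transfer data h of g,
    -- and u = t (∏ h) t⁻¹, the class of u has image d(g)^2
    × ((T : Transversal N r s) (g : Mat) (h : Fin (Transversal.n T) → Mat) (u : Mat) →
         Φ N r s g → TransferData T g h → u · t ≡ t · prod h →
         d u ≡ d g * d g [mod 2 ^ r ])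
lemma3p4 N r s _ N%2≡1 2≤s s≤r =
    (λ g h Φg _ → ≋⇒≡-mod (d-· g h (Γ₀-c g (proj₂ Φg))))
  , CokerRel⇔d≡ N r s N-odd
  , (λ y y≡1 → map₂ (map₂ ≋⇒≡-mod) (d-surjective N r s N-odd 1≤s s≤r (≡-mod⇒≋ y≡1)))
  , λ T g h u Φg th ut≡tp →
      ≋⇒≡-mod (≋-trans (≋-reflexive (d-conj-t u (prod h) ut≡tp)) (d-transfer N r s 1≤s T g h Φg th))
  where
  N-odd : (+ N) ≋ 1ℤ [mod 2 ]
  N-odd = odd⇒≋1 N%2≡1
  1≤s : 1 ≤ s
  1≤s = ℕ.<⇒≤ 2≤s
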